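{- If $(G, \mathcal{U})$ is an elementary non-reconfigurable instance, then $\mathbf{RG}(G, \mathcal{U})$ is disconnected.
   Context: For a graph $G$ and a partition $\mathcal{U}$ of $V(G)$, an independent transversal (IT) of $(G,\mathcal{U})$ is an independent set of $G$ containing exactly one vertex from each block. The reconfiguration graph $\mathbf{RG}(G,\mathcal{U})$ has the IT's as vertices, two IT's $S,T$ being adjacent if $S\cup T$ is an independent set of size $|\mathcal{U}|+1$. When $G,\mathcal{U}$ are empty, $\mathbf{RG}$ is a single vertex. $G-U$ is $G$ with the vertices of $U$ deleted. An elementary non-reconfigurable instance is a pair $(G,\mathcal{U})$ where $G$ is a disjoint union of $m$ complete bipartite graphs $K_{A_1,B_1}\sqcup\cdots\sqcup K_{A_m,B_m}$ with nonempty parts $A_i,B_i$, $\mathcal{U}=\{U_1,\dots,U_m\}$ is a partition of $V(G)$ such that each block $U_i$ can be associated with a distinct component $K_{A_i,B_i}$ with $A_i\subseteq U_i$, and $\mathbf{RG}(G-U_i,\mathcal{U}-\{U_i\})$ is connected for all $U_i\in\mathcal{U}$. -}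

module Defs where

open import Data.Nat using (ℕ; suc)
open import Data.Bool using (Bool; true; false; not)
open import Data.Fin using (Fin)
open import Data.Fin.Subset using (Subset; _∈_; _⊆_; _∪_; ∣_∣; ⊤; ∁; ⁅_⁆)
open import Data.Vec using (tabulate)
open import Data.Product using (Σ; _×_; ∃; _,_)
open import Relation.Nullary using (¬_; ⌊_⌋)
open import Relation.Binary.PropositionalEquality using (_≡_; _≢_)
open import Relation.Binary.Construct.Closure.ReflexiveTransitive using (Star)
import Data.Fin as F

-- An "instance" is a vertex set W ⊆ Fin n (inducing the subgraph G[W]),
-- together with a partition of W into the blocks
--   U_j = { v ∈ W | β v ≡ j }   for j ∈ J  (J ⊆ Fin m the set of block labels).
-- (For the full instance W = ⊤, J = ⊤; for G - U_i we take W = vertices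
--  not in U_i and J = ⊤ minus i.)

module _ {n m : ℕ} (E : Fin n → Fin n → Set) (W : Subset n)
         (β : Fin n → Fin m) (J : Subset m) where

  Independent : Subset n → Set
  Independent S = ∀ u v → u ∈ S → v ∈ S → ¬ E u v

  ExactlyOneIn : Subset n → Fin m → Set
  ExactlyOneIn S j =
    Σ (Fin n) λ v → (v ∈ S × β v ≡ j) ×
      (∀ w → w ∈ S → β w ≡ j → w ≡ v)

  IsIT : Subset n → Set
  IsIT S = S ⊆ W × Independent S × (∀ j → j ∈ J → ExactlyOneIn S j)

  IT : Set
  IT = Σ (Subset n) IsIT

  -- adjacency in the reconfiguration graph RG:
  -- S ∪ T is independent of size |𝒰| + 1 (|𝒰| = ∣ J ∣ blocks)
  RGAdj : IT → IT → Set
  RGAdj (S , _) (T , _) = Independent (S ∪ T) × ∣ S ∪ T ∣ ≡ suc ∣ J ∣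

  RGConnected : Set
  RGConnected = (S T : IT) → Star RGAdj S T

outsideBlock : {n m : ℕ} → (Fin n → Fin m) → Fin m → Subset n
outsideBlock β i = tabulate λ v → not ⌊ β v F.≟ i ⌋

-- (G, 𝒰) is an elementary non-reconfigurable instance:
--  * G (on Fin n) is the disjoint union of m complete bipartite graphs
--    K_{A_i,B_i}, described by comp v (index of the component of v) and
--    side v (true: v ∈ A_{comp v}, false: v ∈ B_{comp v}); E u v holds iff
--    u, v lie in the same component and on different sides;
--  * all parts A_i, B_i are nonempty;
--  * block U_i (= β⁻¹ i) is associated with component i and A_i ⊆ U_i;
--  * RG(G - U_i, 𝒰 - {U_i}) is connected for every i.
record Elementary {n m : ℕ} (E : Fin n → Fin n → Set) (β : Fin n → Fin m) : Set where
  field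
    comp : Fin n → Fin m
    side : Fin n → Bool
    edges-to : ∀ u v → E u v → comp u ≡ comp v × side u ≢ side v
    edges-from : ∀ u v → comp u ≡ comp v → side u ≢ side v → E u v
    A-nonempty : ∀ i → ∃ λ v → comp v ≡ i × side v ≡ true
    B-nonempty : ∀ i → ∃ λ v → comp v ≡ i × side v ≡ false
    A⊆U : ∀ i v → comp v ≡ i → side v ≡ true → β v ≡ i
    minus-connected : ∀ i → RGConnected E (outsideBlock β i) β (∁ ⁅ i ⁆)

-- The transversal taking an A-vertex from every component is isolated in RG:
-- if S ⊆ A is an IT and S ∪ T is independent, a B-vertex v of T would be
-- adjacent to the vertex of S in block U_{comp v}, which lies in A_{comp v}
-- because A_i ⊆ U_i.  So it suffices to exhibit an IT that uses a B-vertex.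
-- Let next c be the block containing the chosen B-vertex of component c.  The
-- map next on the m block labels has a periodic point and permutes its periodic
-- points; taking the B-vertex in periodic components and the A-vertex
-- elsewhere meets every block exactly once.
module Submission where

open import Defs
open import Data.Bool using (Bool; true; false; not)
open import Data.Fin using (Fin; zero; toℕ; fromℕ<; _≟_; punchOut)
open import Data.Fin.Properties
  using (any?; pigeonhole; toℕ<n; toℕ-fromℕ<; injective⇒≤; punchOut-injective)
open import Data.Fin.Subset using (Subset; _∈_; ⊤)
open import Data.Fin.Subset.Properties using (⊆⊤; ∈⊤; x∈p∪q⁺)
open import Data.Nat using (ℕ; suc; pred; _+_; _*_; _≤_; _<_; s≤s; s≤s⁻¹)
open import Data.Nat.Properties using (+-comm; *-comm; n<1+n; m≤n+m; m≤n⇒∃[o]m+o≡n; 1+n≰n; ≤-trans)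
open import Data.Product using (Σ-syntax; ∃; ∃-syntax; _×_; _,_; proj₁; proj₂)
open import Data.Sum using (inj₁; inj₂)
open import Data.Vec using (tabulate)
open import Data.Vec.Properties using ([]=⇒lookup; lookup⇒[]=; lookup∘tabulate)
open import Function using (const; id; _∘_)
open import Function.Definitions using (Injective)
import Function.Endo.Propositional as Endo
open import Level using (0ℓ)
open import Relation.Binary.Definitions using (DecidableEquality; _Respects_)
open import Relation.Binary.Construct.Closure.ReflexiveTransitive using (Star; ε; _◅_)
open import Relation.Binary.PropositionalEquality
open import Relation.Nullary using (¬_; Dec; yes; no; does; proof; contradiction)
open import Relation.Nullary.Decidable using (dec-true; dec-false)
open import Relation.Nullary.Reflects using (Reflects; invert)
open import Relation.Unary using (Pred; Decidable)

module _ {n : ℕ} {p} {P : Pred (Fin n) p} (P? : Decidable P) where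

  subsetOf : Subset n
  subsetOf = tabulate (λ v → does (P? v))

  ∈-subsetOf⁺ : ∀ {v} → P v → v ∈ subsetOf
  ∈-subsetOf⁺ {v} p = lookup⇒[]= v subsetOf (trans (lookup∘tabulate _ v) (dec-true (P? v) p))

  ∈-subsetOf⁻ : ∀ {v} → v ∈ subsetOf → P v
  ∈-subsetOf⁻ {v} v∈ = invert (subst (Reflects (P v)) does≡true (proof (P? v)))
    where
    does≡true : does (P? v) ≡ true
    does≡true = trans (sym (lookup∘tabulate _ v)) ([]=⇒lookup v∈)

injective⇒surjective : ∀ {n} {h : Fin n → Fin n} → Injective _≡_ _≡_ h → ∀ j → ∃[ c ] h c ≡ j
injective⇒surjective {suc n} {h} h-injective j with any? (λ c → h c ≟ j)
... | yes hit = hit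
... | no miss = contradiction (injective⇒≤ punched-injective) 1+n≰n
  where
  j≢h : ∀ c → j ≢ h c
  j≢h c j≡hc = miss (c , sym j≡hc)

  punched : Fin (suc n) → Fin n
  punched c = punchOut (j≢h c)

  punched-injective : Injective _≡_ _≡_ punched
  punched-injective {c} {c′} eq = h-injective (punchOut-injective (j≢h c) (j≢h c′) eq)

module Iteration {a} {A : Set a} (f : A → A) where
  open Endo A using (_^_; ^-homo)

  ^-+ : ∀ p q x → (f ^ (p + q)) x ≡ (f ^ p) ((f ^ q) x)
  ^-+ p q x = cong-app (^-homo f p q) x

  ^-commute : ∀ p q x → (f ^ p) ((f ^ q) x) ≡ (f ^ q) ((f ^ p) x)
  ^-commute p q x = begin
    (f ^ p) ((f ^ q) x)  ≡⟨ ^-+ p q x ⟨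
    (f ^ (p + q)) x      ≡⟨ cong (λ r → (f ^ r) x) (+-comm p q) ⟩
    (f ^ (q + p)) x      ≡⟨ ^-+ q p x ⟩
    (f ^ q) ((f ^ p) x)  ∎
    where open ≡-Reasoning

  ^-*-fixed : ∀ t p {x} → (f ^ p) x ≡ x → (f ^ (t * p)) x ≡ x
  ^-*-fixed 0       p     e = refl
  ^-*-fixed (suc t) p {x} e = begin
    (f ^ (p + t * p)) x       ≡⟨ ^-+ p (t * p) x ⟩
    (f ^ p) ((f ^ (t * p)) x) ≡⟨ cong (f ^ p) (^-*-fixed t p e) ⟩
    (f ^ p) x                 ≡⟨ e ⟩
    x                         ∎
    where open ≡-Reasoning

  Periodic : ℕ → Pred A a
  Periodic n x = Σ[ k ∈ Fin n ] (f ^ suc (toℕ k)) x ≡ x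

  periodic? : DecidableEquality A → ∀ n → Decidable (Periodic n)
  periodic? _≟A_ n x = any? (λ k → (f ^ suc (toℕ k)) x ≟A x)

  periodic-f : ∀ {n x} → Periodic n x → Periodic n (f x)
  periodic-f {x = x} (k , e) = k , trans (^-commute (suc (toℕ k)) 1 x) (cong f e)

  fixed-f-injective : ∀ r {x y} → (f ^ suc r) x ≡ x → (f ^ suc r) y ≡ y → f x ≡ f y → x ≡ y
  fixed-f-injective r {x} {y} ex ey fx≡fy = begin
    x                ≡⟨ ex ⟨
    (f ^ suc r) x    ≡⟨ ^-commute r 1 x ⟨
    (f ^ r) (f x)    ≡⟨ cong (f ^ r) fx≡fy ⟩
    (f ^ r) (f y)    ≡⟨ ^-commute r 1 y ⟩
    (f ^ suc r) y    ≡⟨ ey ⟩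
    y                ∎
    where open ≡-Reasoning

  -- Both points are fixed by f ^ (p * q), where p and q are their periods.
  periodic-injective : ∀ {n x y} → Periodic n x → Periodic n y → f x ≡ f y → x ≡ y
  periodic-injective {x = x} (k , ex) (l , ey) =
    fixed-f-injective (pred (p * q))
      (subst (λ r → (f ^ r) x ≡ x) (*-comm q p) (^-*-fixed q p ex))
      (^-*-fixed p q ey)
    where
    p = suc (toℕ k)
    q = suc (toℕ l)

module _ {m} (f : Fin m → Fin m) where
  open Endo (Fin m) using (_^_)
  open Iteration f

  periodic-exists : Fin m → ∃ (Periodic m)
  periodic-exists z with pigeonhole (n<1+n m) (λ (i : Fin (suc m)) → (f ^ toℕ i) z)
  ... | i , j , i<j , fⁱz≡fʲz with m≤n⇒∃[o]m+o≡n i<j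
  ... | o , i+1+o≡j = (f ^ toℕ i) z , fromℕ< o<m , returns
    where
    o<m : o < m
    o<m = ≤-trans (s≤s (m≤n+m o (toℕ i))) (subst (_≤ m) (sym i+1+o≡j) (s≤s⁻¹ (toℕ<n j)))

    returns : (f ^ suc (toℕ (fromℕ< o<m))) ((f ^ toℕ i) z) ≡ (f ^ toℕ i) z
    returns = begin
      (f ^ suc (toℕ (fromℕ< o<m))) ((f ^ toℕ i) z)
        ≡⟨ cong (λ r → (f ^ suc r) ((f ^ toℕ i) z)) (toℕ-fromℕ< o<m) ⟩
      (f ^ suc o) ((f ^ toℕ i) z)
        ≡⟨ ^-+ (suc o) (toℕ i) z ⟨
      (f ^ suc (o + toℕ i)) z
        ≡⟨ cong (λ r → (f ^ r) z) (trans (cong suc (+-comm o (toℕ i))) i+1+o≡j) ⟩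
      (f ^ toℕ j) z
        ≡⟨ fⁱz≡fʲz ⟨
      (f ^ toℕ i) z
        ∎
      where open ≡-Reasoning

module ElementaryInstance {n m} {E : Fin n → Fin n → Set} {β : Fin n → Fin m}
                          (el : Elementary E β) where
  open Elementary el

  rep : Bool → Fin m → Fin n
  rep true  c = proj₁ (A-nonempty c)
  rep false c = proj₁ (B-nonempty c)

  comp-rep : ∀ s c → comp (rep s c) ≡ c
  comp-rep true  c = proj₁ (proj₂ (A-nonempty c))
  comp-rep false c = proj₁ (proj₂ (B-nonempty c))

  side-rep : ∀ s c → side (rep s c) ≡ s
  side-rep true  c = proj₂ (proj₂ (A-nonempty c))
  side-rep false c = proj₂ (proj₂ (B-nonempty c))

  β-rep-true : ∀ c → β (rep true c) ≡ c
  β-rep-true c = A⊆U c (rep true c) (comp-rep true c) (side-rep true c)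

  Chosen : (Fin m → Bool) → Pred (Fin n) 0ℓ
  Chosen σ v = v ≡ rep (σ (comp v)) (comp v)

  chosen? : ∀ σ → Decidable (Chosen σ)
  chosen? σ v = v ≟ rep (σ (comp v)) (comp v)

  choice : (Fin m → Bool) → Subset n
  choice σ = subsetOf (chosen? σ)

  rep∈choice : ∀ σ c → rep (σ c) c ∈ choice σ
  rep∈choice σ c = ∈-subsetOf⁺ (chosen? σ) (cong (λ c′ → rep (σ c′) c′) (sym (comp-rep (σ c) c)))

  -- A choice has one vertex per component, and edges stay inside components.
  choice-independent : ∀ σ → Independent E ⊤ β ⊤ (choice σ)
  choice-independent σ u v u∈ v∈ uv-edge = side-u≢side-v (cong side u≡v)
    where
    comp-u≡comp-v = proj₁ (edges-to u v uv-edge)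
    side-u≢side-v = proj₂ (edges-to u v uv-edge)
    u≡v : u ≡ v
    u≡v = trans (∈-subsetOf⁻ (chosen? σ) u∈)
            (trans (cong (λ c → rep (σ c) c) comp-u≡comp-v) (sym (∈-subsetOf⁻ (chosen? σ) v∈)))

  choiceIT : ∀ σ → Injective _≡_ _≡_ (λ c → β (rep (σ c) c)) → IT E ⊤ β ⊤
  choiceIT σ blocks-injective = choice σ , ⊆⊤ , choice-independent σ , exactlyOne
    where
    exactlyOne : ∀ j → j ∈ ⊤ → ExactlyOneIn E ⊤ β ⊤ (choice σ) j
    exactlyOne j _ = rep (σ c) c , (rep∈choice σ c , βc≡j) , unique
      where
      c = proj₁ (injective⇒surjective blocks-injective j)
      βc≡j = proj₂ (injective⇒surjective blocks-injective j)
      unique : ∀ w → w ∈ choice σ → β w ≡ j → w ≡ rep (σ c) c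
      unique w w∈ βw≡j = trans w-chosen (cong (λ c′ → rep (σ c′) c′) comp-w≡c)
        where
        w-chosen = ∈-subsetOf⁻ (chosen? σ) w∈
        comp-w≡c = blocks-injective (trans (cong β (sym w-chosen)) (trans βw≡j (sym βc≡j)))

  allA : IT E ⊤ β ⊤
  allA = choiceIT (const true) λ {c} {c′} eq → trans (sym (β-rep-true c)) (trans eq (β-rep-true c′))

  OnSideA : Pred (IT E ⊤ β ⊤) 0ℓ
  OnSideA (S , _) = ∀ {v} → v ∈ S → side v ≡ true

  allA-onSideA : OnSideA allA
  allA-onSideA {v} v∈ = trans (cong side (∈-subsetOf⁻ (chosen? (const true)) v∈)) (side-rep true (comp v))

  onSideA-respects-RGAdj : OnSideA Respects RGAdj E ⊤ β ⊤
  onSideA-respects-RGAdj {S , _ , _ , exactlyOne} (S∪T-independent , _) S⊆A {v} v∈T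
    with side v in side-v | exactlyOne (comp v) ∈⊤
  ... | true  | _ = refl
  ... | false | s , (s∈S , βs≡comp-v) , _ =
    contradiction (edges-from s v comp-s≡comp-v sides-differ)
                  (S∪T-independent s v (x∈p∪q⁺ (inj₁ s∈S)) (x∈p∪q⁺ (inj₂ v∈T)))
    where
    comp-s≡comp-v : comp s ≡ comp v
    comp-s≡comp-v = trans (sym (A⊆U (comp s) s refl (S⊆A s∈S))) βs≡comp-v
    sides-differ : side s ≢ side v
    sides-differ = subst₂ _≢_ (sym (S⊆A s∈S)) (sym side-v) λ ()

  onSideA-respects-Star : OnSideA Respects Star (RGAdj E ⊤ β ⊤)
  onSideA-respects-Star ε                     = id
  onSideA-respects-Star {S} (_◅_ {j = M} r rs) = onSideA-respects-Star rs ∘ onSideA-respects-RGAdj {S} {M} r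

  next : Fin m → Fin m
  next c = β (rep false c)

  open Iteration next using (Periodic; periodic?; periodic-f; periodic-injective)

  OnCycle : Pred (Fin m) 0ℓ
  OnCycle = Periodic m

  onCycle? : Decidable OnCycle
  onCycle? = periodic? _≟_ m

  cycleSide : Fin m → Bool
  cycleSide c = not (does (onCycle? c))

  cycleBlock : Fin m → Fin m
  cycleBlock c = β (rep (cycleSide c) c)

  cycleBlock-onCycle : ∀ {c} → OnCycle c → cycleBlock c ≡ next c
  cycleBlock-onCycle {c} p = cong (λ b → β (rep (not b) c)) (dec-true (onCycle? c) p)

  cycleBlock-offCycle : ∀ {c} → ¬ OnCycle c → cycleBlock c ≡ c
  cycleBlock-offCycle {c} ¬p = trans (cong (λ b → β (rep (not b) c)) (dec-false (onCycle? c) ¬p)) (β-rep-true c)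

  cycleBlock-separates : ∀ {c c′} → OnCycle c → ¬ OnCycle c′ → cycleBlock c ≢ cycleBlock c′
  cycleBlock-separates p ¬p′ eq =
    ¬p′ (subst OnCycle (trans (sym (cycleBlock-onCycle p)) (trans eq (cycleBlock-offCycle ¬p′))) (periodic-f p))

  cycleBlock-injective : Injective _≡_ _≡_ cycleBlock
  cycleBlock-injective {c} {c′} eq = byCases (onCycle? c) (onCycle? c′)
    where
    byCases : Dec (OnCycle c) → Dec (OnCycle c′) → c ≡ c′
    byCases (yes p) (yes p′) = periodic-injective p p′
                                 (trans (sym (cycleBlock-onCycle p)) (trans eq (cycleBlock-onCycle p′)))
    byCases (no ¬p) (no ¬p′) = trans (sym (cycleBlock-offCycle ¬p)) (trans eq (cycleBlock-offCycle ¬p′))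
    byCases (yes p) (no ¬p′) = contradiction eq (cycleBlock-separates p ¬p′)
    byCases (no ¬p) (yes p′) = contradiction (sym eq) (cycleBlock-separates p′ ¬p)

  cycleIT : IT E ⊤ β ⊤
  cycleIT = choiceIT cycleSide cycleBlock-injective

  cycleIT-meets-B : Fin m → ∃[ v ] (v ∈ proj₁ cycleIT × side v ≡ false)
  cycleIT-meets-B z = rep (cycleSide c) c , rep∈choice cycleSide c ,
                       trans (side-rep (cycleSide c) c) (cong not (dec-true (onCycle? c) c-onCycle))
    where
    c = proj₁ (periodic-exists next z)
    c-onCycle = proj₂ (periodic-exists next z)

lemma2p3 : {n m : ℕ} → 1 ≤ m → (E : Fin n → Fin n → Set) → (β : Fin n → Fin m)
    → Elementary E β → ¬ RGConnected E ⊤ β ⊤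
lemma2p3 {m = suc _} _ E β el connected =
  let v , v∈cycleIT , v-onSideB = cycleIT-meets-B zero
      allA⇝cycleIT = connected allA cycleIT
      v-onSideA = onSideA-respects-Star allA⇝cycleIT allA-onSideA v∈cycleIT
  in contradiction (trans (sym v-onSideA) v-onSideB) λ ()
  where open ElementaryInstance el
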